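{- In the graceful game, Bob has a winning strategy on every helm $H_n$, $n\geq 3$ (no matter who starts).
   Context: The helm $H_n$ ($n\geq 3$) has a center $v_0$, cycle vertices $v_1,\dots,v_n$ forming a cycle and all adjacent to $v_0$, and pendent vertices $v_{n+1},\dots,v_{2n}$, where $v_{n+k}$ is adjacent only to $v_k$ ($1\leq k\leq n$). It has $2n+1$ vertices and $3n$ edges. A graceful labeling of a graph $G$ with $m$ edges is an injective map $f\colon V(G)\to\{0,1,\dots,m\}$ such that the induced edge labels $|f(u)-f(v)|$, $uv\in E(G)$, are pairwise distinct. The graceful game on a simple graph $G$ with $m$ edges: two players, Alice and Bob, alternately choose a free (not yet labeled) vertex and assign to it a label from $\{0,1,\dots,m\}$ not yet used. An edge both of whose endpoints are labeled gets label $|f(u)-f(v)|$; a move is legal only if after it all edge labels are pairwise distinct. Alice wins if the whole graph ends up gracefully labeled; Bob wins if he can prevent this. Either player may be the first to move. -}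

module Defs where

open import Data.Nat using (ℕ; zero; suc; _+_; _∸_; _≤_; _<_; _≡ᵇ_; ∣_-_∣)
open import Data.Bool using (if_then_else_)
open import Data.Maybe using (Maybe; just; nothing)
open import Data.Product using (_×_; _,_; ∃)
open import Data.List using (List; []; _∷_; _++_; map; length; upTo; lookup)
open import Data.Fin using (Fin)
open import Relation.Nullary using (¬_)
open import Relation.Binary.PropositionalEquality using (_≡_; _≢_)

-- A finite simple graph: vertices are the naturals 0 .. order-1,
-- edges are given as a list of unordered pairs (each edge listed once).
record Graph : Set where
  field
    order : ℕ
    edges : List (ℕ × ℕ)

open Graph public

size : Graph → ℕ
size G = length (edges G)

-- Helm H_n: center 0, cycle vertices 1..n, pendant vertex n+k attached to k.
helm : ℕ → Graph
helm n = record
  { order = suc (n + n)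
  ; edges = spokes ++ (rim ++ pendants)
  }
  where
  spokes   = map (λ k → (0 , suc k)) (upTo n)
  rim      = map (λ k → (suc k , suc (suc k))) (upTo (n ∸ 1)) ++ ((n , 1) ∷ [])
  pendants = map (λ k → (suc k , suc (n + k))) (upTo n)

-- A partial labeling: nothing = vertex still free.
Labeling : Set
Labeling = ℕ → Maybe ℕ

emptyLabeling : Labeling
emptyLabeling _ = nothing

assign : Labeling → ℕ → ℕ → Labeling
assign f v l u = if u ≡ᵇ v then just l else f u

edgeLabel : Labeling → ℕ × ℕ → Maybe ℕ
edgeLabel f (a , b) with f a | f b
... | just x | just y = just ∣ x - y ∣
... | _      | _      = nothing

EdgeLabelsDistinct : Graph → Labeling → Set
EdgeLabelsDistinct G f =
  (i j : Fin (length (edges G))) → i ≢ j → (x y : ℕ) →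
  edgeLabel f (lookup (edges G) i) ≡ just x →
  edgeLabel f (lookup (edges G) j) ≡ just y → x ≢ y

Legal : Graph → Labeling → ℕ → ℕ → Set
Legal G f v l =
  (v < order G) × (f v ≡ nothing) × (l ≤ size G) ×
  ((u : ℕ) → u < order G → f u ≢ just l) ×
  EdgeLabelsDistinct G (assign f v l)

Complete : Graph → Labeling → Set
Complete G f = (v : ℕ) → v < order G → ∃ λ l → f v ≡ just l

Graceful : Graph → Labeling → Set
Graceful G f =
  Complete G f ×
  ((v : ℕ) → v < order G → (l : ℕ) → f v ≡ just l → l ≤ size G) ×
  ((u v : ℕ) → u < order G → v < order G → (l : ℕ) → f u ≡ just l → f v ≡ just l → u ≡ v) ×
  EdgeLabelsDistinct G f

data Player : Set where
  alice bob : Player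

-- The game ends when the player to move has no legal move; Alice wins iff
-- the final labeling is graceful (all moves legal), Bob wins otherwise.
data BobWins (G : Graph) : Player → Labeling → Set where
  aliceTurn : ∀ {f} → ¬ Graceful G f →
    (∀ v l → Legal G f v l → BobWins G bob (assign f v l)) →
    BobWins G alice f
  bobMove : ∀ {f} v l → ¬ Graceful G f → Legal G f v l →
    BobWins G alice (assign f v l) → BobWins G bob f
  bobStuck : ∀ {f} → ¬ Graceful G f → (∀ v l → ¬ Legal G f v l) →
    BobWins G bob f

-- In a graceful labeling of a graph with m edges some edge carries the label m, so the
-- vertices labeled 0 and m are adjacent; likewise the label m − 1 lies on an edge {0, m − 1}
-- or {1, m}.  On the helm (m = 3n) a pendant vertex has a single neighbour, hence a pendant
-- labeled 0 (resp. m) forces the label m (resp. 0) on its cycle vertex, and two pendants cannot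
-- carry 0 and 1 (resp. m and m − 1).  Bob exploits this: he puts 0 on a pendant, so Alice must
-- answer m on its cycle vertex, and then 1 on a second pendant leaves no graceful completion;
-- if Alice answers anything else, Bob spends the label m elsewhere.  Every opening move of Alice
-- is refuted in the same way, and once no graceful completion exists Bob wins however the rest
-- of the game is played.
module Submission where

open import Defs
open import Data.Nat
  using (ℕ; zero; suc; _+_; _∸_; _≤_; _<_; _≡ᵇ_; ∣_-_∣; z≤n; s≤s; s≤s⁻¹; z<s; s<s; pred;
         NonZero; ≢-nonZero; _≟_; _<?_; _≤?_)
open import Data.Nat.Properties
  using (≡ᵇ⇒≡; ≡⇒≡ᵇ; suc-injective; 1+n≢n; ≤-refl; ≤-reflexive; ≤-trans; ≤-total; <-trans;
         <-≤-trans; <⇒≤; <⇒≢; ≤∧≢⇒<; ≮⇒≥; n<1+n; m≤m+n; m≤n+m; n≤0⇒n≡0; m<n⇒n≢0; +-mono-≤;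
         +-monoʳ-<; +-cancelˡ-≡; m+n≤o⇒m≤o∸n; m∸n≤m; n∸n≡0; m+[n∸m]≡n; m∸n+n≡m; m∸[m∸n]≡n;
         m+n∸m≡n; m<n⇒0<n∸m; m>n⇒m∸n≢0; ∸-monoˡ-<; ∸-monoʳ-<; ∣m-n∣≡0⇒m≡n; ∣m-n∣≤m⊔n;
         m≤n⇒∣m-n∣≡n∸m; ∣-∣-comm; ⊔-lub; pred-mono-<; pred-injective; suc-pred; allUpTo?)
open import Data.Bool using (true; false)
open import Data.Maybe using (Maybe; just; nothing)
open import Data.Maybe.Properties using (just-injective; ≡-dec)
open import Data.Product using (_×_; _,_; ∃; ∃₂; proj₁; proj₂; uncurry)
open import Data.Sum using (_⊎_; inj₁; inj₂; swap; [_,_]′)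
open import Data.List using (List; []; _∷_; _++_; map; length; lookup; upTo; applyUpTo)
open import Data.List.Properties using (length-map; length-++; length-upTo)
open import Data.Fin as Fin using (Fin; toℕ; fromℕ<)
open import Data.Fin.Properties
  using (any?; all?; toℕ-fromℕ<; fromℕ<-injective; toℕ-injective; punchOut-injective; <⇒notInjective)
open import Data.Empty using (⊥)
open import Function using (_∘_; id)
open import Function.Definitions using (Injective)
open import Relation.Nullary using (¬_; Dec; yes; no; contradiction)
open import Relation.Nullary.Decidable using (_×-dec_; _→-dec_; ¬?; map′)
open import Relation.Binary.PropositionalEquality
  using (_≡_; _≢_; refl; sym; trans; cong; cong₂; subst; subst₂; module ≡-Reasoning)

-- Partial labelings

assign-same : ∀ f v l → assign f v l v ≡ just l
assign-same f v l with v ≡ᵇ v | ≡⇒≡ᵇ v v refl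
... | true | _ = refl

assign-other : ∀ f v l {u} → u ≢ v → assign f v l u ≡ f u
assign-other f v l {u} u≢v with u ≡ᵇ v | ≡ᵇ⇒≡ u v
... | false | _ = refl
... | true | u≡v = contradiction (u≡v _) u≢v

free-assign : ∀ f v l {u} → u ≢ v → f u ≡ nothing → assign f v l u ≡ nothing
free-assign f v l u≢v fu = trans (assign-other f v l u≢v) fu

Unused : Labeling → ℕ → Set
Unused f x = ∀ u → f u ≢ just x

unused-empty : ∀ {x} → Unused emptyLabeling x
unused-empty _ ()

unused-assign : ∀ {f} v l {x} → l ≢ x → Unused f x → Unused (assign f v l) x
unused-assign {f} v l l≢x unused u fu with u ≟ v
... | yes refl = l≢x (just-injective (trans (sym (assign-same f v l)) fu))
... | no u≢v = unused u (trans (sym (assign-other f v l u≢v)) fu)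

_⊑_ : Labeling → Labeling → Set
f ⊑ g = ∀ {v l} → f v ≡ just l → g v ≡ just l

⊑-assign : ∀ f v l → f v ≡ nothing → f ⊑ assign f v l
⊑-assign f v l fv {u} fu with u ≟ v
... | yes refl = contradiction (trans (sym fv) fu) λ ()
... | no u≢v = trans (assign-other f v l u≢v) fu

edgeLabel-labeled : ∀ g a b {x y} → g a ≡ just x → g b ≡ just y → edgeLabel g (a , b) ≡ just ∣ x - y ∣
edgeLabel-labeled g a b ga gb rewrite ga | gb = refl

edgeLabel-just : ∀ g a b {d} → edgeLabel g (a , b) ≡ just d →
  ∃₂ λ x y → g a ≡ just x × g b ≡ just y × ∣ x - y ∣ ≡ d
edgeLabel-just g a b eq with g a | g b
edgeLabel-just g a b refl | just x | just y = x , y , refl , refl , refl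

edgeLabel-freeˡ : ∀ g {a} b → g a ≡ nothing → edgeLabel g (a , b) ≡ nothing
edgeLabel-freeˡ g b ga rewrite ga = refl

edgeLabel-freeʳ : ∀ g a {b} → g b ≡ nothing → edgeLabel g (a , b) ≡ nothing
edgeLabel-freeʳ g a gb with g a
... | nothing = refl
... | just _ rewrite gb = refl

labeledˡ : ∀ g a b {d} → edgeLabel g (a , b) ≡ just d → g a ≢ nothing
labeledˡ g a b labeled ga = contradiction (trans (sym labeled) (edgeLabel-freeˡ g b ga)) λ ()

labeledʳ : ∀ g a b {d} → edgeLabel g (a , b) ≡ just d → g b ≢ nothing
labeledʳ g a b labeled gb = contradiction (trans (sym labeled) (edgeLabel-freeʳ g a gb)) λ ()

edgeLabel-cong : ∀ g h {a b} → g a ≡ h a → g b ≡ h b → edgeLabel g (a , b) ≡ edgeLabel h (a , b)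
edgeLabel-cong g h ga gb rewrite ga | gb = refl

edgeLabel-assign-isolated : ∀ f v l {a b} → f v ≡ nothing → a ≢ b →
  (a ≡ v → f b ≡ nothing) → (b ≡ v → f a ≡ nothing) →
  edgeLabel (assign f v l) (a , b) ≡ edgeLabel f (a , b)
edgeLabel-assign-isolated f v l {a} {b} fv a≢b a-free b-free with a ≟ v | b ≟ v
... | yes refl | yes refl = contradiction refl a≢b
... | yes refl | no b≢v =
  trans (edgeLabel-freeʳ (assign f v l) a (free-assign f v l b≢v (a-free refl))) (sym (edgeLabel-freeʳ f a (a-free refl)))
... | no a≢v | yes refl =
  trans (edgeLabel-freeˡ (assign f v l) b (free-assign f v l a≢v (b-free refl))) (sym (edgeLabel-freeˡ f b (b-free refl)))
... | no a≢v | no b≢v = edgeLabel-cong (assign f v l) f (assign-other f v l a≢v) (assign-other f v l b≢v)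

∣-∣-ordered : ∀ x y → (y ≡ x + ∣ x - y ∣) ⊎ (x ≡ y + ∣ x - y ∣)
∣-∣-ordered x y with ≤-total x y
... | inj₁ x≤y = inj₁ (trans (sym (m+[n∸m]≡n x≤y)) (cong (x +_) (sym (m≤n⇒∣m-n∣≡n∸m x≤y))))
... | inj₂ y≤x = inj₂ (trans (sym (m+[n∸m]≡n y≤x)) (cong (y +_) (sym (trans (∣-∣-comm x y) (m≤n⇒∣m-n∣≡n∸m y≤x)))))

ValidEdge : ℕ → ℕ × ℕ → Set
ValidEdge N (a , b) = a < N × b < N × a ≢ b

WellFormed : Graph → Set
WellFormed G = ∀ i → ValidEdge (order G) (lookup (edges G) i)

Adjacent : Graph → ℕ → ℕ → Set
Adjacent G u v = ∃ λ i → lookup (edges G) i ≡ (u , v) ⊎ lookup (edges G) i ≡ (v , u)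

adjacent-sym : ∀ {G u v} → Adjacent G u v → Adjacent G v u
adjacent-sym (i , e) = i , swap e

NeighboursFree : Graph → Labeling → ℕ → Set
NeighboursFree G f v = ∀ {u} → Adjacent G u v → f u ≡ nothing

distinct-if-single : ∀ {G} g b → (∀ i {d} → edgeLabel g (lookup (edges G) i) ≡ just d → toℕ i ≡ b) →
  EdgeLabelsDistinct G g
distinct-if-single g b single i j i≢j x y li lj _ =
  i≢j (toℕ-injective (trans (single i {x} li) (sym (single j {y} lj))))

module _ {G : Graph} (wf : WellFormed G) where

  adjacent⇒< : ∀ {u v} → Adjacent G u v → u < order G × v < order G
  adjacent⇒< (i , inj₁ eq) with wf i
  ... | a< , b< , _ rewrite eq = a< , b<
  adjacent⇒< (i , inj₂ eq) with wf i
  ... | a< , b< , _ rewrite eq = b< , a<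

  distinct-assign-isolated : ∀ f v l → f v ≡ nothing → NeighboursFree G f v →
    EdgeLabelsDistinct G f → EdgeLabelsDistinct G (assign f v l)
  distinct-assign-isolated f v l fv free distinct i j i≢j x y li lj =
    distinct i j i≢j x y (trans (sym (unchanged i)) li) (trans (sym (unchanged j)) lj)
    where
    unchanged : ∀ i → edgeLabel (assign f v l) (lookup (edges G) i) ≡ edgeLabel f (lookup (edges G) i)
    unchanged i with lookup (edges G) i in eq | wf i
    ... | a , b | _ , _ , a≢b =
      edgeLabel-assign-isolated f v l fv a≢b (λ { refl → free (i , inj₂ eq) }) (λ { refl → free (i , inj₁ eq) })

-- Labels of graceful labelings

fin-injective⇒surjective : ∀ {m} {f : Fin m → Fin m} → Injective _≡_ _≡_ f → ∀ d → ∃ λ i → f i ≡ d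
fin-injective⇒surjective {suc m} {f} f-injective d with any? (λ i → f i Fin.≟ d)
... | yes hit = hit
... | no miss = contradiction (λ {i} {j} eq → f-injective (punchOut-injective (d≢ i) (d≢ j) eq))
  (<⇒notInjective {f = λ i → Fin.punchOut (d≢ i)} (n<1+n m))
  where
  d≢ : ∀ i → d ≢ f i
  d≢ i d≡fi = miss (i , sym d≡fi)

injective-below⇒onto : ∀ {m} (h : Fin m → ℕ) → (∀ i → h i < m) → (∀ {i j} → h i ≡ h j → i ≡ j) →
  ∀ {d} → d < m → ∃ λ i → h i ≡ d
injective-below⇒onto h h< h-injective d<
  with fin-injective⇒surjective {f = λ i → fromℕ< (h< i)}
         (λ {i} {j} eq → h-injective (fromℕ<-injective _ _ (h< i) (h< j) eq)) (fromℕ< d<)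
... | i , eq = i , trans (sym (toℕ-fromℕ< (h< i))) (trans (cong toℕ eq) (toℕ-fromℕ< d<))

module _ {G : Graph} {g : Labeling} (gr : Graceful G g) where

  graceful-labeled : ∀ {v} → v < order G → ∃ λ x → g v ≡ just x
  graceful-labeled = proj₁ gr _

  graceful-bounded : ∀ {v x} → v < order G → g v ≡ just x → x ≤ size G
  graceful-bounded v< = proj₁ (proj₂ gr) _ v< _

  graceful-injective : ∀ {u v x} → u < order G → v < order G → g u ≡ just x → g v ≡ just x → u ≡ v
  graceful-injective u< v< = proj₁ (proj₂ (proj₂ gr)) _ _ u< v< _

  module _ (wf : WellFormed G) where

    edgeValue : ∀ i → ∃ λ d → edgeLabel g (lookup (edges G) i) ≡ just d × NonZero d × d ≤ size G
    edgeValue i with lookup (edges G) i | wf i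
    ... | a , b | a< , b< , a≢b with graceful-labeled a< | graceful-labeled b<
    ...   | x , ga | y , gb = ∣ x - y ∣ , edgeLabel-labeled g a b ga gb , nonZero , bounded
      where
      nonZero : NonZero ∣ x - y ∣
      nonZero = ≢-nonZero λ ∣x-y∣≡0 →
        a≢b (graceful-injective a< b< ga (trans gb (cong just (sym (∣m-n∣≡0⇒m≡n ∣x-y∣≡0)))))
      bounded : ∣ x - y ∣ ≤ size G
      bounded = ≤-trans (∣m-n∣≤m⊔n x y) (⊔-lub (graceful-bounded a< ga) (graceful-bounded b< gb))

    realized-at : ∀ {d} i → edgeLabel g (lookup (edges G) i) ≡ just d →
      ∃₂ λ u v → Adjacent G u v × ∃ λ x → g u ≡ just x × g v ≡ just (x + d)
    realized-at i labeled with lookup (edges G) i in eq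
    ... | a , b with edgeLabel-just g a b labeled
    ...   | x , y , ga , gb , refl with ∣-∣-ordered x y
    ...     | inj₁ y≡ = a , b , (i , inj₁ eq) , x , ga , trans gb (cong just y≡)
    ...     | inj₂ x≡ = b , a , (i , inj₂ eq) , y , gb , trans ga (cong just x≡)

    -- The m edge labels are distinct and lie in [1, m], so each value in [1, m] occurs.
    graceful-realizes : ∀ {d} → 0 < d → d ≤ size G →
      ∃₂ λ u v → Adjacent G u v × ∃ λ x → g u ≡ just x × g v ≡ just (x + d)
    graceful-realizes {suc d} _ d<m with injective-below⇒onto (pred ∘ value) value< value-injective d<m
      where
      value : Fin (size G) → ℕ
      value i = proj₁ (edgeValue i)
      value< : ∀ i → pred (value i) < size G
      value< i = let _ , _ , nz , v≤m = edgeValue i in pred-mono-< {{nz}} (s≤s v≤m)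
      value-injective : ∀ {i j} → pred (value i) ≡ pred (value j) → i ≡ j
      value-injective {i} {j} eq with i Fin.≟ j
      ... | yes i≡j = i≡j
      ... | no i≢j = let _ , li , nzi , _ = edgeValue i ; _ , lj , nzj , _ = edgeValue j in
        contradiction (pred-injective {{nzi}} {{nzj}} eq) (proj₂ (proj₂ (proj₂ gr)) i j i≢j _ _ li lj)
    ... | i , eq = let _ , labeled , nz , _ = edgeValue i in
      realized-at i (trans labeled (cong just (trans (sym (suc-pred _ {{nz}})) (cong suc eq))))

    adjacent-bounded : ∀ {u v x} → Adjacent G u v → g v ≡ just x → x ≤ size G
    adjacent-bounded adj = graceful-bounded (proj₂ (adjacent⇒< {G} wf adj))

    extremes-adjacent : 0 < size G → ∃₂ λ u v → Adjacent G u v × g u ≡ just 0 × g v ≡ just (size G)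
    extremes-adjacent 0<m with graceful-realizes 0<m ≤-refl
    ... | u , v , adj , x , gu , gv
      with refl ← n≤0⇒n≡0 (subst (x ≤_) (n∸n≡0 (size G)) (m+n≤o⇒m≤o∸n x (adjacent-bounded adj gv)))
      = u , v , adj , gu , gv

    next-to-extremes : 1 < size G → ∃₂ λ u v → Adjacent G u v ×
      ((g u ≡ just 0 × g v ≡ just (size G ∸ 1)) ⊎ (g u ≡ just 1 × g v ≡ just (size G)))
    next-to-extremes 1<m with graceful-realizes (m<n⇒0<n∸m 1<m) (m∸n≤m (size G) 1)
    ... | u , v , adj , x , gu , gv
      with subst (x ≤_) (m∸[m∸n]≡n (<⇒≤ 1<m)) (m+n≤o⇒m≤o∸n x (adjacent-bounded adj gv))
    ...   | z≤n = u , v , adj , inj₁ (gu , gv)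
    ...   | s≤s z≤n = u , v , adj , inj₂ (gu , trans gv (cong just (m+[n∸m]≡n (<⇒≤ 1<m))))

-- The game

-- Records rather than abbreviations, so that G and f can be inferred from them.
record Doomed (G : Graph) (f : Labeling) : Set where
  constructor doomed
  field no-graceful-extension : ∀ {g} → Graceful G g → f ⊑ g → ⊥

record Forced (G : Graph) (f : Labeling) (u x : ℕ) : Set where
  constructor forced
  field forced-label : ∀ {g} → Graceful G g → f ⊑ g → g u ≡ just x

open Doomed
open Forced

free⇒¬graceful : ∀ G {f v} → v < order G → f v ≡ nothing → ¬ Graceful G f
free⇒¬graceful G v< fv gr with proj₁ gr _ v<
... | _ , fv≡just = contradiction (trans (sym fv) fv≡just) λ ()

doomed⇒¬graceful : ∀ {G f} → Doomed G f → ¬ Graceful G f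
doomed⇒¬graceful d gr = no-graceful-extension d gr (λ e → e)

module _ {G : Graph} where

  doomed-assign : ∀ {f} v l → f v ≡ nothing → Doomed G f → Doomed G (assign f v l)
  doomed-assign {f} v l fv d = doomed λ gr f⊑g → no-graceful-extension d gr (f⊑g ∘ ⊑-assign f v l fv)

  forced-assign : ∀ {f u x} v l → f v ≡ nothing → Forced G f u x → Forced G (assign f v l) u x
  forced-assign {f} v l fv F = forced λ gr f⊑g → forced-label F gr (f⊑g ∘ ⊑-assign f v l fv)

  forced⇒doomed-if-taken : ∀ {f u w x} → Forced G f u x → u < order G → w < order G → w ≢ u →
    f w ≡ just x → Doomed G f
  forced⇒doomed-if-taken F u< w< w≢u fw = doomed λ gr f⊑g →
    w≢u (graceful-injective {G} gr w< u< (f⊑g fw) (forced-label F gr f⊑g))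

  forced⇒doomed-if-mislabeled : ∀ {f u x y} → Forced G f u x → f u ≡ just y → y ≢ x → Doomed G f
  forced⇒doomed-if-mislabeled F fu y≢x = doomed λ gr f⊑g →
    y≢x (just-injective (trans (sym (f⊑g fu)) (forced-label F gr f⊑g)))

freeCount : Labeling → ℕ → ℕ
freeCount f zero = 0
freeCount f (suc N) = isFree (f N) + freeCount f N
  where
  isFree : Maybe ℕ → ℕ
  isFree nothing = 1
  isFree (just _) = 0

freeCount-assign-≤ : ∀ f v l N → freeCount (assign f v l) N ≤ freeCount f N
freeCount-assign-≤ f v l zero = z≤n
freeCount-assign-≤ f v l (suc N) with N ≟ v
... | yes refl rewrite assign-same f v l = ≤-trans (freeCount-assign-≤ f v l N) (m≤n+m _ _)
... | no N≢v rewrite assign-other f v l N≢v = +-mono-≤ ≤-refl (freeCount-assign-≤ f v l N)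

freeCount-assign-< : ∀ f v l {N} → v < N → f v ≡ nothing → freeCount (assign f v l) N < freeCount f N
freeCount-assign-< f v l {suc N} (s≤s v≤N) fv with N ≟ v
... | yes refl rewrite assign-same f v l | fv = s≤s (freeCount-assign-≤ f v l N)
... | no N≢v rewrite assign-other f v l N≢v =
  +-monoʳ-< _ (freeCount-assign-< f v l (≤∧≢⇒< v≤N (N≢v ∘ sym)) fv)

edgeLabelsDistinct? : ∀ G f → Dec (EdgeLabelsDistinct G f)
edgeLabelsDistinct? G f = all? λ i → all? λ j →
  ¬? (i Fin.≟ j) →-dec distinct? (edgeLabel f (lookup (edges G) i)) (edgeLabel f (lookup (edges G) j))
  where
  distinct? : (a b : Maybe ℕ) → Dec (∀ x y → a ≡ just x → b ≡ just y → x ≢ y)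
  distinct? (just x) (just y) with x ≟ y
  ... | yes x≡y = no λ h → h x y refl refl x≡y
  ... | no x≢y = yes λ { _ _ refl refl → x≢y }
  distinct? nothing _ = yes λ _ _ ()
  distinct? (just _) nothing = yes λ _ _ _ ()

legal? : ∀ G f v l → Dec (Legal G f v l)
legal? G f v l =
  v <? order G ×-dec ≡-dec _≟_ (f v) nothing ×-dec l ≤? size G ×-dec
  map′ (λ h u u< → h u<) (λ h {u} u< → h u u<) (allUpTo? (λ u → ¬? (≡-dec _≟_ (f u) (just l))) (order G)) ×-dec
  edgeLabelsDistinct? G (assign f v l)

someLegal? : ∀ G f → Dec (∃₂ (Legal G f))
someLegal? G f = map′ fromFin toFin (any? λ v → any? λ l → legal? G f (toℕ v) (toℕ {suc (size G)} l))
  where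
  fromFin : ∃₂ (λ v l → Legal G f (toℕ v) (toℕ l)) → ∃₂ (Legal G f)
  fromFin (v , l , legal) = toℕ v , toℕ l , legal
  toFin : ∃₂ (Legal G f) → ∃₂ (λ v l → Legal G f (toℕ v) (toℕ l))
  toFin (v , l , legal@(v< , _ , l≤m , _)) = fromℕ< v< , fromℕ< (s≤s l≤m) ,
    subst₂ (Legal G f) (sym (toℕ-fromℕ< _)) (sym (toℕ-fromℕ< _)) legal

module _ {G : Graph} where

  bobWins-doomed′ : ∀ c f → freeCount f (order G) < c → Doomed G f → ∀ p → BobWins G p f
  bobWins-doomed′ (suc c) f fc<c d = play
    where
    next : ∀ v l → Legal G f v l → ∀ p → BobWins G p (assign f v l)
    next v l (v< , fv , _) = bobWins-doomed′ c (assign f v l)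
      (<-≤-trans (freeCount-assign-< f v l v< fv) (s≤s⁻¹ fc<c)) (doomed-assign v l fv d)
    play : ∀ p → BobWins G p f
    play alice = aliceTurn (doomed⇒¬graceful d) λ v l legal → next v l legal bob
    play bob with someLegal? G f
    ... | no none = bobStuck (doomed⇒¬graceful d) λ v l legal → none (v , l , legal)
    ... | yes (v , l , legal) = bobMove v l (doomed⇒¬graceful d) legal (next v l legal alice)

  bobWins-doomed : ∀ {f} → Doomed G f → ∀ p → BobWins G p f
  bobWins-doomed {f} = bobWins-doomed′ (suc (freeCount f (order G))) f ≤-refl

module _ {G : Graph} where

  bob-plays : ∀ {f v l} → Legal G f v l → BobWins G alice (assign f v l) → BobWins G bob f
  bob-plays legal@(v< , fv , _) = bobMove _ _ (free⇒¬graceful G v< fv) legal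

  bob-dooms : ∀ {f v l} → Legal G f v l → Doomed G (assign f v l) → BobWins G bob f
  bob-dooms legal d = bob-plays legal (bobWins-doomed d alice)

  bob-blocks : ∀ {f u w x} → Forced G f u x → u < order G → Legal G f w x → w ≢ u → BobWins G bob f
  bob-blocks {f} {w = w} {x} F u< legal@(w< , fw , _) w≢u =
    bob-dooms legal (forced⇒doomed-if-taken (forced-assign w x fw F) u< w< w≢u (assign-same f w x))

  alice-forced : ∀ {f u x} → Forced G f u x → u < order G → f u ≡ nothing →
    (Legal G f u x → BobWins G bob (assign f u x)) →
    (∀ v l → Legal G f v l → v ≢ u → l ≢ x → BobWins G bob (assign f v l)) →
    BobWins G alice f
  alice-forced {f} {u} {x} F u< fu expected deviation = aliceTurn (free⇒¬graceful G u< fu) reply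
    where
    reply : ∀ v l → Legal G f v l → BobWins G bob (assign f v l)
    reply v l legal@(v< , fv , _) with v ≟ u | l ≟ x
    ... | yes refl | yes refl = expected legal
    ... | yes refl | no l≢x =
      bobWins-doomed (forced⇒doomed-if-mislabeled (forced-assign v l fv F) (assign-same f v l) l≢x) bob
    ... | no v≢u | yes refl =
      bobWins-doomed (forced⇒doomed-if-taken (forced-assign v l fv F) u< v< v≢u (assign-same f v l)) bob
    ... | no v≢u | no l≢x = deviation v l legal v≢u l≢x

-- The helm

module _ {A : Set} where

  lookup-++ : (xs ys : List A) (i : Fin (length (xs ++ ys))) →
    (∃ λ j → toℕ i ≡ toℕ j × lookup (xs ++ ys) i ≡ lookup xs j) ⊎
    (∃ λ j → toℕ i ≡ length xs + toℕ j × lookup (xs ++ ys) i ≡ lookup ys j)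
  lookup-++ [] ys i = inj₂ (i , refl , refl)
  lookup-++ (x ∷ xs) ys Fin.zero = inj₁ (Fin.zero , refl , refl)
  lookup-++ (x ∷ xs) ys (Fin.suc i) with lookup-++ xs ys i
  ... | inj₁ (j , i≡j , eq) = inj₁ (Fin.suc j , cong suc i≡j , eq)
  ... | inj₂ (j , i≡j , eq) = inj₂ (j , cong suc i≡j , eq)

  lookup-map-applyUpTo : (h : ℕ → A) (g : ℕ → ℕ) (n : ℕ) (j : Fin (length (map h (applyUpTo g n)))) →
    toℕ j < n × lookup (map h (applyUpTo g n)) j ≡ h (g (toℕ j))
  lookup-map-applyUpTo h g (suc n) Fin.zero = z<s , refl
  lookup-map-applyUpTo h g (suc n) (Fin.suc j) with lookup-map-applyUpTo h (g ∘ suc) n j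
  ... | j<n , eq = s<s j<n , eq

module HelmGraph (n : ℕ) (1<n : 1 < n) where

  H : Graph
  H = helm n

  -- c t and p t are the paper's v_(t+1) and v_(n+t+1); the hub v_0 is 0.
  c p : ℕ → ℕ
  c t = suc t
  p t = suc (n + t)

  data HelmEdge (i : ℕ) : ℕ × ℕ → Set where
    spoke       : ∀ {t} → t < n → i ≡ t → HelmEdge i (0 , c t)
    rim         : ∀ {s t} → s < n → t < n → s ≢ t → HelmEdge i (c s , c t)
    pendantEdge : ∀ {t} → t < n → i ≡ n + (n + t) → HelmEdge i (c t , p t)

  private
    spokes rimPath rims pendants : List (ℕ × ℕ)
    spokes = map (λ t → 0 , c t) (upTo n)
    rimPath = map (λ t → c t , c (suc t)) (upTo (n ∸ 1))
    rims = rimPath ++ (n , 1) ∷ []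
    pendants = map (λ t → c t , p t) (upTo n)

    1≤n : 1 ≤ n
    1≤n = <⇒≤ 1<n

    length-spokes : length spokes ≡ n
    length-spokes = trans (length-map _ (upTo n)) (length-upTo n)

    length-rims : length rims ≡ n
    length-rims = begin
      length rims         ≡⟨ length-++ rimPath ⟩
      length rimPath + 1  ≡⟨ cong (_+ 1) (trans (length-map _ (upTo (n ∸ 1))) (length-upTo (n ∸ 1))) ⟩
      n ∸ 1 + 1           ≡⟨ m∸n+n≡m 1≤n ⟩
      n                   ∎
      where open ≡-Reasoning

  helmEdge : ∀ i → HelmEdge (toℕ i) (lookup (edges H) i)
  helmEdge i with lookup-++ spokes (rims ++ pendants) i
  ... | inj₁ (j , i≡j , eq) with lookup-map-applyUpTo (λ t → 0 , c t) id n j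
  ...   | j<n , eq′ rewrite eq | eq′ = spoke j<n i≡j
  helmEdge i | inj₂ (j , i≡ , eq) with lookup-++ rims pendants j
  ... | inj₂ (k , j≡ , eq′) with lookup-map-applyUpTo (λ t → c t , p t) id n k
  ...   | k<n , eq″ rewrite eq | eq′ | eq″ =
    pendantEdge k<n (trans i≡ (cong₂ _+_ length-spokes (trans j≡ (cong (_+ toℕ k) length-rims))))
  helmEdge i | inj₂ (j , _ , eq) | inj₁ (k , _ , eq′) with lookup-++ rimPath ((n , 1) ∷ []) k
  ... | inj₁ (l , _ , eq″) with lookup-map-applyUpTo (λ t → c t , c (suc t)) id (n ∸ 1) l
  ...   | l<n∸1 , eq‴ rewrite eq | eq′ | eq″ | eq‴ = rim (<-trans (n<1+n _) 1+l<n) 1+l<n (1+n≢n ∘ sym)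
    where
    1+l<n : suc (toℕ l) < n
    1+l<n = ≤-trans (s≤s l<n∸1) (≤-reflexive (m+[n∸m]≡n 1≤n))
  helmEdge i | inj₂ (j , _ , eq) | inj₁ (k , _ , eq′) | inj₂ (Fin.zero , _ , eq″) rewrite eq | eq′ | eq″ =
    subst (λ a → HelmEdge (toℕ i) (a , 1)) (m+[n∸m]≡n 1≤n)
      (rim (∸-monoʳ-< z<s 1≤n) (<-trans z<s 1<n) (m<n⇒n≢0 (m<n⇒0<n∸m 1<n)))

  c<order : ∀ {t} → t < n → c t < order H
  c<order t<n = s<s (≤-trans t<n (m≤m+n n n))

  p<order : ∀ {t} → t < n → p t < order H
  p<order t<n = s<s (+-monoʳ-< n t<n)

  c≢p : ∀ {t k} → t < n → c t ≢ p k
  c≢p {k = k} t<n = <⇒≢ (s<s (<-≤-trans t<n (m≤m+n n k)))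

  p-injective : ∀ {j k} → p j ≡ p k → j ≡ k
  p-injective = +-cancelˡ-≡ n _ _ ∘ suc-injective

  helm-wellFormed : WellFormed H
  helm-wellFormed i = valid (helmEdge i)
    where
    valid : ∀ {i e} → HelmEdge i e → ValidEdge (order H) e
    valid (spoke t<n _) = z<s , c<order t<n , λ ()
    valid (rim s<n t<n s≢t) = c<order s<n , c<order t<n , s≢t ∘ suc-injective
    valid (pendantEdge t<n _) = c<order t<n , p<order t<n , c≢p t<n

  adjacent-pendant : ∀ {u k} → Adjacent H u (p k) → u ≡ c k
  adjacent-pendant {u} {k} (i , inj₁ eq) = into (helmEdge i) eq
    where
    into : ∀ {i e} → HelmEdge i e → e ≡ (u , p k) → u ≡ c k
    into (spoke t<n _) eq = contradiction (cong proj₂ eq) (c≢p t<n)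
    into (rim _ t<n _) eq = contradiction (cong proj₂ eq) (c≢p t<n)
    into (pendantEdge _ _) eq = trans (sym (cong proj₁ eq)) (cong c (p-injective (cong proj₂ eq)))
  adjacent-pendant {u} {k} (i , inj₂ eq) = outof (helmEdge i) eq
    where
    outof : ∀ {i e} → HelmEdge i e → e ≡ (p k , u) → u ≡ c k
    outof (spoke _ _) ()
    outof (rim s<n _ _) eq = contradiction (cong proj₁ eq) (c≢p s<n)
    outof (pendantEdge t<n _) eq = contradiction (cong proj₁ eq) (c≢p t<n)

  m : ℕ
  m = size H

  n≤m : n ≤ m
  n≤m = ≤-trans (≤-reflexive (sym length-spokes)) (≤-trans (m≤m+n _ _) (≤-reflexive (sym (length-++ spokes))))

  1<m : 1 < m
  1<m = <-≤-trans 1<n n≤m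

  m∸1≢m : m ∸ 1 ≢ m
  m∸1≢m = <⇒≢ (∸-monoʳ-< z<s (<⇒≤ 1<m))

  module _ {g} (gr : Graceful H g) where

    pendant-partner : ∀ {k u v x} → k < n → Adjacent H u v → g u ≡ just x → g (p k) ≡ just x → v ≡ c k
    pendant-partner k<n adj gu gpk
      with refl ← graceful-injective {H} gr (proj₁ (adjacent⇒< {H} helm-wellFormed adj)) (p<order k<n) gu gpk
      = adjacent-pendant (adjacent-sym {H} adj)

    pendant-0⇒cycle-m : ∀ {k} → k < n → g (p k) ≡ just 0 → g (c k) ≡ just m
    pendant-0⇒cycle-m k<n gpk with extremes-adjacent {H} gr helm-wellFormed (<-trans z<s 1<m)
    ... | _ , _ , adj , gu , gv with refl ← pendant-partner k<n adj gu gpk = gv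

    pendant-m⇒cycle-0 : ∀ {k} → k < n → g (p k) ≡ just m → g (c k) ≡ just 0
    pendant-m⇒cycle-0 k<n gpk with extremes-adjacent {H} gr helm-wellFormed (<-trans z<s 1<m)
    ... | _ , _ , adj , gu , gv with refl ← pendant-partner k<n (adjacent-sym {H} adj) gv gpk = gu

    pendants-0-1 : ∀ {j k} → j < n → k < n → g (p k) ≡ just 0 → g (p j) ≡ just 1 → j ≡ k
    pendants-0-1 j<n k<n gpk gpj with next-to-extremes {H} gr helm-wellFormed 1<m
    ... | _ , _ , adj , inj₁ (gu , gv) with refl ← pendant-partner k<n adj gu gpk =
      contradiction (just-injective (trans (sym gv) (pendant-0⇒cycle-m k<n gpk))) m∸1≢m
    ... | _ , _ , adj , inj₂ (gu , gv) with refl ← pendant-partner j<n adj gu gpj =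
      suc-injective (graceful-injective {H} gr (c<order j<n) (c<order k<n) gv (pendant-0⇒cycle-m k<n gpk))

    pendants-m-m∸1 : ∀ {j k} → j < n → k < n → g (p k) ≡ just m → g (p j) ≡ just (m ∸ 1) → j ≡ k
    pendants-m-m∸1 j<n k<n gpk gpj with next-to-extremes {H} gr helm-wellFormed 1<m
    ... | _ , _ , adj , inj₁ (gu , gv) with refl ← pendant-partner j<n (adjacent-sym {H} adj) gv gpj =
      suc-injective (graceful-injective {H} gr (c<order j<n) (c<order k<n) gu (pendant-m⇒cycle-0 k<n gpk))
    ... | _ , _ , adj , inj₂ (gu , gv) with refl ← pendant-partner k<n (adjacent-sym {H} adj) gv gpk =
      contradiction (just-injective (trans (sym gu) (pendant-m⇒cycle-0 k<n gpk))) λ ()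

  legal-pendant : ∀ {f j x} → j < n → EdgeLabelsDistinct H f → f (c j) ≡ nothing → f (p j) ≡ nothing →
    x ≤ m → Unused f x → Legal H f (p j) x
  legal-pendant {f} {j} {x} j<n distinct fc fp x≤m unused =
    p<order j<n , fp , x≤m , (λ u _ → unused u) ,
    distinct-assign-isolated {H} helm-wellFormed f (p j) x fp
      (λ adj → subst (λ u → f u ≡ nothing) (sym (adjacent-pendant adj)) fc) distinct

  CycleFreeExcept : Labeling → ℕ → Set
  CycleFreeExcept f b = ∀ {t} → t < n → f (c t) ≡ nothing ⊎ (t ≡ b × f (p t) ≡ nothing)

  legal-hub : ∀ {f b x} → f 0 ≡ nothing → CycleFreeExcept f b → x ≤ m → Unused f x → Legal H f 0 x
  legal-hub {f} {b} {x} f0 cycleFree x≤m unused =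
    z<s , f0 , x≤m , (λ u _ → unused u) , distinct-if-single {H} g b λ i → only-spoke (helmEdge i)
    where
    g : Labeling
    g = assign f 0 x
    free : ∀ {u} → f u ≡ nothing → u ≢ 0 → g u ≡ nothing
    free fu u≢0 = free-assign f 0 x u≢0 fu
    only-spoke : ∀ {i e d} → HelmEdge i e → edgeLabel g e ≡ just d → i ≡ b
    only-spoke (spoke {t} t<n i≡t) labeled with cycleFree t<n
    ... | inj₁ fc = contradiction (free fc λ ()) (labeledʳ g 0 (c t) labeled)
    ... | inj₂ (t≡b , _) = trans i≡t t≡b
    only-spoke (rim {s} {t} s<n t<n s≢t) labeled with cycleFree s<n | cycleFree t<n
    ... | inj₁ fc | _ = contradiction (free fc λ ()) (labeledˡ g (c s) (c t) labeled)
    ... | _ | inj₁ fc = contradiction (free fc λ ()) (labeledʳ g (c s) (c t) labeled)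
    ... | inj₂ (s≡b , _) | inj₂ (t≡b , _) = contradiction (trans s≡b (sym t≡b)) s≢t
    only-spoke (pendantEdge {t} t<n _) labeled with cycleFree t<n
    ... | inj₁ fc = contradiction (free fc λ ()) (labeledˡ g (c t) (p t) labeled)
    ... | inj₂ (_ , fp) = contradiction (free fp λ ()) (labeledʳ g (c t) (p t) labeled)

  legal-pendant-beside : ∀ {f j x} → j < n → (∀ {u} → u ≢ c j → f u ≡ nothing) → f (p j) ≡ nothing →
    x ≤ m → Unused f x → Legal H f (p j) x
  legal-pendant-beside {f} {j} {x} j<n onlyCycle fp x≤m unused =
    p<order j<n , fp , x≤m , (λ u _ → unused u) , distinct-if-single {H} g (n + (n + j)) λ i → only-pendant (helmEdge i)
    where
    g : Labeling
    g = assign f (p j) x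
    free : ∀ u → u ≢ c j → u ≢ p j → g u ≡ nothing
    free _ u≢c u≢p = free-assign f (p j) x u≢p (onlyCycle u≢c)
    only-pendant : ∀ {i e d} → HelmEdge i e → edgeLabel g e ≡ just d → i ≡ n + (n + j)
    only-pendant (spoke {t} _ _) labeled = contradiction (free 0 (λ ()) (λ ())) (labeledˡ g 0 (c t) labeled)
    only-pendant (rim {s} {t} s<n t<n s≢t) labeled with s ≟ j | t ≟ j
    ... | no s≢j | _ = contradiction (free (c s) (s≢j ∘ suc-injective) (c≢p s<n)) (labeledˡ g (c s) (c t) labeled)
    ... | _ | no t≢j = contradiction (free (c t) (t≢j ∘ suc-injective) (c≢p t<n)) (labeledʳ g (c s) (c t) labeled)
    ... | yes refl | yes refl = contradiction refl s≢t
    only-pendant (pendantEdge {t} t<n i≡) labeled with t ≟ j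
    ... | yes refl = i≡
    ... | no t≢j = contradiction (free (c t) (t≢j ∘ suc-injective) (c≢p t<n)) (labeledˡ g (c t) (p t) labeled)

-- Bob's strategy on the helm

another-index : ∀ a → ∃ λ k → k < 2 × k ≢ a
another-index zero = 1 , ≤-refl , λ ()
another-index (suc _) = 0 , z<s , λ ()

third-index : ∀ a k → ∃ λ j → j < 3 × j ≢ a × j ≢ k
third-index zero zero = 1 , s<s z<s , (λ ()) , (λ ())
third-index zero (suc zero) = 2 , ≤-refl , (λ ()) , (λ ())
third-index zero (suc (suc _)) = 1 , s<s z<s , (λ ()) , (λ ())
third-index (suc zero) zero = 2 , ≤-refl , (λ ()) , (λ ())
third-index (suc (suc _)) zero = 1 , s<s z<s , (λ ()) , (λ ())
third-index (suc _) (suc _) = 0 , z<s , (λ ()) , (λ ())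

module HelmGame (n : ℕ) (2<n : 2 < n) where

  1<n : 1 < n
  1<n = <-trans (n<1+n 1) 2<n

  0<n : 0 < n
  0<n = <-trans z<s 1<n

  open HelmGraph n 1<n

  data Vertex : ℕ → Set where
    hub     : Vertex 0
    cycle   : ∀ {t} → t < n → Vertex (c t)
    pendant : ∀ {t} → t < n → Vertex (p t)

  vertex : ∀ {v} → v < order H → Vertex v
  vertex {zero} _ = hub
  vertex {suc w} (s≤s w<2n) with w <? n
  ... | yes w<n = cycle w<n
  ... | no w≮n = subst Vertex (cong suc (m+[n∸m]≡n (≮⇒≥ w≮n)))
    (pendant (subst (w ∸ n <_) (m+n∸m≡n n n) (∸-monoˡ-< w<2n (≮⇒≥ w≮n))))

  avoid : ∀ v {j k} → j < n → k < n → j ≢ k → (c j ≢ v × p j ≢ v) ⊎ (c k ≢ v × p k ≢ v)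
  avoid v {j} {k} j<n k<n j≢k with v ≟ c j | v ≟ p j
  ... | yes refl | _ = inj₂ (j≢k ∘ sym ∘ suc-injective , c≢p j<n ∘ sym)
  ... | no v≢c | yes refl = inj₂ (c≢p k<n , j≢k ∘ sym ∘ p-injective)
  ... | no v≢c | no v≢p = inj₁ (v≢c ∘ sym , v≢p ∘ sym)

  forced-cycle-m : ∀ {f k} → k < n → f (p k) ≡ just 0 → Forced H f (c k) m
  forced-cycle-m k<n fpk = forced λ gr f⊑g → pendant-0⇒cycle-m gr k<n (f⊑g fpk)

  forced-cycle-0 : ∀ {f k} → k < n → f (p k) ≡ just m → Forced H f (c k) 0
  forced-cycle-0 k<n fpk = forced λ gr f⊑g → pendant-m⇒cycle-0 gr k<n (f⊑g fpk)

  doomed-0-1 : ∀ {f j k} → j < n → k < n → j ≢ k → f (p k) ≡ just 0 → f (p j) ≡ just 1 → Doomed H f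
  doomed-0-1 j<n k<n j≢k fpk fpj = doomed λ gr f⊑g → j≢k (pendants-0-1 gr j<n k<n (f⊑g fpk) (f⊑g fpj))

  doomed-m-m∸1 : ∀ {f j k} → j < n → k < n → j ≢ k → f (p k) ≡ just m → f (p j) ≡ just (m ∸ 1) → Doomed H f
  doomed-m-m∸1 j<n k<n j≢k fpk fpj = doomed λ gr f⊑g → j≢k (pendants-m-m∸1 gr j<n k<n (f⊑g fpk) (f⊑g fpj))

  block-at-pendant : ∀ {f u j z} → Forced H f u z → u < order H → j < n → p j ≢ u →
    EdgeLabelsDistinct H f → f (c j) ≡ nothing → f (p j) ≡ nothing → z ≤ m → Unused f z → BobWins H bob f
  block-at-pendant F u< j<n p≢u distinct fc fp z≤m unused =
    bob-blocks F u< (legal-pendant j<n distinct fc fp z≤m unused) p≢u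

  block-at-hub : ∀ {f u b z} → Forced H f u z → u < order H → u ≢ 0 → f 0 ≡ nothing →
    CycleFreeExcept f b → z ≤ m → Unused f z → BobWins H bob f
  block-at-hub F u< u≢0 f0 cycleFree z≤m unused =
    bob-blocks F u< (legal-hub f0 cycleFree z≤m unused) (u≢0 ∘ sym)

  -- Bob puts x on a pendant; Alice must answer x̄ on its cycle vertex, after which y on a second
  -- pendant leaves no graceful completion, and any other answer lets Bob spend x̄ elsewhere.
  module Opening (x x̄ y : ℕ) (x≤m : x ≤ m) (x̄≤m : x̄ ≤ m) (y≤m : y ≤ m)
    (x≢x̄ : x ≢ x̄) (y≢x : y ≢ x) (y≢x̄ : y ≢ x̄)
    (partner : ∀ {f k} → k < n → f (p k) ≡ just x → Forced H f (c k) x̄)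
    (follow-up : ∀ {f j k} → j < n → k < n → j ≢ k → f (p k) ≡ just x → f (p j) ≡ just y → Doomed H f)
    where

    bob-opens : ∀ {f k} → k < n → EdgeLabelsDistinct H f → f (c k) ≡ nothing → f (p k) ≡ nothing → Unused f x →
      (Legal H (assign f (p k) x) (c k) x̄ → BobWins H bob (assign (assign f (p k) x) (c k) x̄)) →
      (∀ v l → Legal H (assign f (p k) x) v l → v ≢ c k → l ≢ x̄ → BobWins H bob (assign (assign f (p k) x) v l)) →
      BobWins H bob f
    bob-opens {f} {k} k<n distinct fc fp unused expected deviation =
      bob-plays (legal-pendant k<n distinct fc fp x≤m unused)
        (alice-forced (partner k<n (assign-same f (p k) x)) (c<order k<n) (free-assign f (p k) x (c≢p k<n) fc)
          expected deviation)

    open-from-hub : ∀ {f} → (∀ {t} → t < n → f (c t) ≡ nothing) → (∀ {t} → t < n → f (p t) ≡ nothing) →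
      Unused f x → Unused f x̄ → Unused f y → EdgeLabelsDistinct H f → BobWins H bob f
    open-from-hub {f} cfree pfree ux ux̄ uy distinct =
      bob-opens 0<n distinct (cfree 0<n) (pfree 0<n) ux expected deviation
      where
      f₁ : Labeling
      f₁ = assign f (p 0) x
      fc₁ : ∀ {t} → t < n → f₁ (c t) ≡ nothing
      fc₁ t<n = free-assign f (p 0) x (c≢p t<n) (cfree t<n)
      fp₁ : ∀ {t} → t < n → t ≢ 0 → f₁ (p t) ≡ nothing
      fp₁ t<n t≢0 = free-assign f (p 0) x (t≢0 ∘ p-injective) (pfree t<n)

      expected : Legal H f₁ (c 0) x̄ → BobWins H bob (assign f₁ (c 0) x̄)
      expected (_ , fc0 , _ , _ , distinct₂) =
        bob-dooms (legal-pendant 1<n distinct₂ fc fp y≤m unused)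
          (follow-up 1<n 0<n (λ ()) (⊑-assign f₂ (p 1) y fp {p 0} (⊑-assign f₁ (c 0) x̄ fc0 (assign-same f (p 0) x)))
            (assign-same f₂ (p 1) y))
        where
        f₂ : Labeling
        f₂ = assign f₁ (c 0) x̄
        fc : f₂ (c 1) ≡ nothing
        fc = free-assign f₁ (c 0) x̄ (λ ()) (fc₁ 1<n)
        fp : f₂ (p 1) ≡ nothing
        fp = free-assign f₁ (c 0) x̄ (c≢p 0<n ∘ sym) (fp₁ 1<n λ ())
        unused : Unused f₂ y
        unused = unused-assign (c 0) x̄ (y≢x̄ ∘ sym) (unused-assign (p 0) x (y≢x ∘ sym) uy)

      deviation : ∀ v l → Legal H f₁ v l → v ≢ c 0 → l ≢ x̄ → BobWins H bob (assign f₁ v l)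
      deviation v l (_ , fv , _ , _ , distinct₂) v≢c0 l≢x̄ =
        [ uncurry (block 1<n λ ()) , uncurry (block 2<n λ ()) ]′ (avoid v 1<n 2<n λ ())
        where
        block : ∀ {j} → j < n → j ≢ 0 → c j ≢ v → p j ≢ v → BobWins H bob (assign f₁ v l)
        block j<n j≢0 c≢v p≢v =
          block-at-pendant (forced-assign v l fv (partner 0<n (assign-same f (p 0) x))) (c<order 0<n) j<n
            (c≢p 0<n ∘ sym) distinct₂ (free-assign f₁ v l c≢v (fc₁ j<n)) (free-assign f₁ v l p≢v (fp₁ j<n j≢0))
            x̄≤m (unused-assign v l l≢x̄ (unused-assign (p 0) x x≢x̄ ux̄))

    answer-x̄ : ∀ {w} → w < order H → EdgeLabelsDistinct H (assign emptyLabeling w x̄) →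
      BobWins H bob (assign emptyLabeling w x̄)
    answer-x̄ {w} w< distinct = [ uncurry (reply 0<n) , uncurry (reply 1<n) ]′ (avoid w 0<n 1<n λ ())
      where
      f : Labeling
      f = assign emptyLabeling w x̄
      reply : ∀ {j} → j < n → c j ≢ w → p j ≢ w → BobWins H bob f
      reply {j} j<n c≢w p≢w =
        bob-dooms (legal-pendant j<n distinct fc fp x≤m (unused-assign w x̄ (x≢x̄ ∘ sym) unused-empty))
          (forced⇒doomed-if-taken (partner j<n (assign-same f (p j) x)) (c<order j<n) w< (c≢w ∘ sym)
            (⊑-assign f (p j) x fp {w} (assign-same emptyLabeling w x̄)))
        where
        fc : f (c j) ≡ nothing
        fc = free-assign emptyLabeling w x̄ c≢w refl
        fp : f (p j) ≡ nothing
        fp = free-assign emptyLabeling w x̄ p≢w refl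

    module PendantOpening {a l k j} (a<n : a < n) (k<n : k < n) (j<n : j < n)
      (k≢a : k ≢ a) (j≢a : j ≢ a) (j≢k : j ≢ k) (l≢x̄ : l ≢ x̄) where

      f₀ f₁ : Labeling
      f₀ = assign emptyLabeling (p a) l
      f₁ = assign f₀ (p k) x
      free₀ : ∀ {u} → u ≢ p a → f₀ u ≡ nothing
      free₀ u≢pa = free-assign emptyLabeling (p a) l u≢pa refl
      fpk : f₀ (p k) ≡ nothing
      fpk = free₀ (k≢a ∘ p-injective)
      free₁ : ∀ {u} → u ≢ p a → u ≢ p k → f₁ u ≡ nothing
      free₁ u≢pa u≢pk = free-assign f₀ (p k) x u≢pk (free₀ u≢pa)
      F : Forced H f₁ (c k) x̄
      F = partner k<n (assign-same f₀ (p k) x)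

      expected : Legal H f₁ (c k) x̄ → BobWins H bob (assign f₁ (c k) x̄)
      expected (_ , fck , _ , _ , distinct₂) with l ≟ y
      ... | yes refl =
        bobWins-doomed (follow-up a<n k<n (k≢a ∘ sym) (⊑-assign f₁ (c k) x̄ fck {p k} (assign-same f₀ (p k) x))
          (⊑-assign f₁ (c k) x̄ fck {p a} (⊑-assign f₀ (p k) x fpk {p a} (assign-same emptyLabeling (p a) l)))) bob
      ... | no l≢y =
        bob-dooms (legal-pendant j<n distinct₂ fc fp y≤m unused)
          (follow-up j<n k<n j≢k (⊑-assign f₂ (p j) y fp {p k} (⊑-assign f₁ (c k) x̄ fck {p k} (assign-same f₀ (p k) x)))
            (assign-same f₂ (p j) y))
        where
        f₂ : Labeling
        f₂ = assign f₁ (c k) x̄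
        fc : f₂ (c j) ≡ nothing
        fc = free-assign f₁ (c k) x̄ (j≢k ∘ suc-injective) (free₁ (c≢p j<n) (c≢p j<n))
        fp : f₂ (p j) ≡ nothing
        fp = free-assign f₁ (c k) x̄ (c≢p k<n ∘ sym) (free₁ (j≢a ∘ p-injective) (j≢k ∘ p-injective))
        unused : Unused f₂ y
        unused = unused-assign (c k) x̄ (y≢x̄ ∘ sym) (unused-assign (p k) x (y≢x ∘ sym)
          (unused-assign (p a) l l≢y unused-empty))

      module Deviation (v l′ : ℕ) (fv : f₁ v ≡ nothing) (l′≢x̄ : l′ ≢ x̄) where
        f₂ : Labeling
        f₂ = assign f₁ v l′
        F₂ : Forced H f₂ (c k) x̄
        F₂ = forced-assign v l′ fv F
        free₂ : ∀ {u} → u ≢ v → u ≢ p a → u ≢ p k → f₂ u ≡ nothing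
        free₂ u≢v u≢pa u≢pk = free-assign f₁ v l′ u≢v (free₁ u≢pa u≢pk)
        unused : Unused f₂ x̄
        unused = unused-assign v l′ l′≢x̄ (unused-assign (p k) x x≢x̄ (unused-assign (p a) l l≢x̄ unused-empty))

      -- If Alice's answer took c j or p j, the hub may be the only place left for x̄ (when n = 3).
      deviation : ∀ v l′ → Legal H f₁ v l′ → v ≢ c k → l′ ≢ x̄ → BobWins H bob (assign f₁ v l′)
      deviation v l′ (_ , fv , _ , _ , distinct₂) v≢ck l′≢x̄ with v ≟ c j | v ≟ p j
      ... | yes refl | _ = block-at-hub F₂ (c<order k<n) (λ ()) (free₂ {0} (λ ()) (λ ()) (λ ())) cycleFree x̄≤m unused
        where
        open Deviation v l′ fv l′≢x̄
        cycleFree : CycleFreeExcept f₂ j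
        cycleFree {t} t<n with t ≟ j
        ... | yes refl = inj₂ (refl , free₂ (c≢p t<n ∘ sym) (j≢a ∘ p-injective) (j≢k ∘ p-injective))
        ... | no t≢j = inj₁ (free₂ (t≢j ∘ suc-injective) (c≢p t<n) (c≢p t<n))
      ... | no _ | yes refl = block-at-hub F₂ (c<order k<n) (λ ()) (free₂ {0} (λ ()) (λ ()) (λ ())) cycleFree x̄≤m unused
        where
        open Deviation v l′ fv l′≢x̄
        cycleFree : CycleFreeExcept f₂ j
        cycleFree t<n = inj₁ (free₂ (c≢p t<n) (c≢p t<n) (c≢p t<n))
      ... | no v≢cj | no v≢pj =
        block-at-pendant F₂ (c<order k<n) j<n (c≢p k<n ∘ sym) distinct₂
          (free₂ (v≢cj ∘ sym) (c≢p j<n) (c≢p j<n)) (free₂ (v≢pj ∘ sym) (j≢a ∘ p-injective) (j≢k ∘ p-injective))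
          x̄≤m unused
        where
        open Deviation v l′ fv l′≢x̄

    answer-pendant : ∀ {a l k j} → a < n → k < n → j < n → k ≢ a → j ≢ a → j ≢ k → l ≢ x → l ≢ x̄ →
      EdgeLabelsDistinct H (assign emptyLabeling (p a) l) → BobWins H bob (assign emptyLabeling (p a) l)
    answer-pendant {a} {l} a<n k<n j<n k≢a j≢a j≢k l≢x l≢x̄ distinct =
      bob-opens k<n distinct (free₀ (c≢p k<n)) fpk (unused-assign (p a) l l≢x unused-empty) expected deviation
      where
      open PendantOpening a<n k<n j<n k≢a j≢a j≢k l≢x̄

  0≢m : 0 ≢ m
  0≢m = <⇒≢ (<-trans z<s 1<m)

  module Zero = Opening 0 m 1 z≤n ≤-refl (<⇒≤ 1<m) 0≢m (λ ()) (<⇒≢ 1<m) forced-cycle-m doomed-0-1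
  module Top = Opening m 0 (m ∸ 1) ≤-refl z≤n (m∸n≤m m 1) (0≢m ∘ sym) m∸1≢m (m>n⇒m∸n≢0 1<m)
    forced-cycle-0 doomed-m-m∸1

  answer-cycle : ∀ {a l} → a < n → l ≢ 0 → l ≢ m → BobWins H bob (assign emptyLabeling (c a) l)
  answer-cycle {a} {l} a<n l≢0 l≢m =
    bob-dooms (legal-pendant-beside a<n only fp z≤n (unused-assign (c a) l l≢0 unused-empty))
      (forced⇒doomed-if-mislabeled (forced-cycle-m a<n (assign-same f (p a) 0))
        (⊑-assign f (p a) 0 fp {c a} (assign-same emptyLabeling (c a) l)) l≢m)
    where
    f : Labeling
    f = assign emptyLabeling (c a) l
    only : ∀ {u} → u ≢ c a → f u ≡ nothing
    only u≢ca = free-assign emptyLabeling (c a) l u≢ca refl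
    fp : f (p a) ≡ nothing
    fp = only (c≢p a<n ∘ sym)

  answer-hub : ∀ {l} → l ≢ 0 → l ≢ m → EdgeLabelsDistinct H (assign emptyLabeling 0 l) →
    BobWins H bob (assign emptyLabeling 0 l)
  answer-hub {l} l≢0 l≢m distinct with l ≟ 1
  ... | yes refl = Top.open-from-hub (λ _ → refl) (λ _ → refl) (unused-assign 0 1 l≢m unused-empty)
    (unused-assign 0 1 l≢0 unused-empty) (unused-assign 0 1 1≢m∸1 unused-empty) distinct
    where
    1≢m∸1 : 1 ≢ m ∸ 1
    1≢m∸1 = <⇒≢ (∸-monoˡ-< (<-≤-trans 2<n n≤m) (s≤s z≤n))
  ... | no l≢1 = Zero.open-from-hub (λ _ → refl) (λ _ → refl) (unused-assign 0 l l≢0 unused-empty)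
    (unused-assign 0 l l≢m unused-empty) (unused-assign 0 l l≢1 unused-empty) distinct

  alice-opens : ∀ v l → Legal H emptyLabeling v l → BobWins H bob (assign emptyLabeling v l)
  alice-opens v l (v< , _ , _ , _ , distinct) with l ≟ 0 | l ≟ m
  ... | yes refl | _ = Top.answer-x̄ v< distinct
  ... | no _ | yes refl = Zero.answer-x̄ v< distinct
  ... | no l≢0 | no l≢m with vertex v<
  ...   | hub = answer-hub l≢0 l≢m distinct
  ...   | cycle a<n = answer-cycle a<n l≢0 l≢m
  ...   | pendant {a} a<n with another-index a
  ...     | k , k<2 , k≢a with third-index a k
  ...       | j , j<3 , j≢a , j≢k =
    Zero.answer-pendant a<n (<-≤-trans k<2 (<⇒≤ 2<n)) (<-≤-trans j<3 2<n) k≢a j≢a j≢k l≢0 l≢m distinct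

  bobWins : ∀ first → BobWins H first emptyLabeling
  bobWins alice = aliceTurn (free⇒¬graceful H z<s refl) alice-opens
  bobWins bob = Zero.open-from-hub (λ _ → refl) (λ _ → refl) unused-empty unused-empty unused-empty λ _ _ _ _ _ ()

theorem9 : (n : ℕ) → 3 ≤ n → (first : Player) → BobWins (helm n) first emptyLabeling
theorem9 = HelmGame.bobWins
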